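{- Let $q\in\mathbb{N}$ with $q\ge 3$ and let $\mathcal{A}\subseteq\{0,1,\ldots,q-1\}$ with $1<\#\mathcal{A}<q$. Let $r=s/t\in(0,1)\cap\mathbb{Q}$ with $s,t\in\mathbb{N}$, $\gcd(s,t)=1$. If $t$ has a prime factor that does not divide $q$, then for every positive rational $\alpha$, the set $\{k\in\mathbb{N}: \alpha r^k\in K(q,\mathcal{A})\}$ is finite.
   Context: $K(q,\mathcal{A}):=\{\sum_{i=1}^\infty d_i q^{ -i}: d_i\in\mathcal{A}\ \forall i\in\mathbb{N}\}$. -}

module Defs where

open import Data.Nat as ℕ using (ℕ; zero; suc)
open import Data.Integer using (+_)
open import Data.Rational using (ℚ; 0ℚ; 1ℚ; _+_; _-_; _*_; _/_; ∣_∣; _<_)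
open import Data.Fin using (Fin; toℕ)
open import Data.Fin.Subset using (Subset; _∈_)
open import Data.Product using (Σ; ∃; _×_)

_^ℚ_ : ℚ → ℕ → ℚ
x ^ℚ zero    = 1ℚ
x ^ℚ (suc k) = x * (x ^ℚ k)

-- 1/q as a rational (for q = 0 returns 0; only used with q ≥ 3)
inv : ℕ → ℚ
inv zero    = 0ℚ
inv (suc n) = (+ 1) / (suc n)

-- partial sums  Σ_{i=1}^{n} d_i q^{-i}, where digit d_i is stored at index i-1
partialSum : (q : ℕ) → (ℕ → Fin q) → ℕ → ℚ
partialSum q d zero    = 0ℚ
partialSum q d (suc n) = partialSum q d n + ((+ toℕ (d n)) / 1) * (inv q ^ℚ suc n)

ConvergesTo : (ℕ → ℚ) → ℚ → Set
ConvergesTo S x = ∀ (ε : ℚ) → 0ℚ < ε → ∃ λ N → ∀ n → N ℕ.≤ n → ∣ S n - x ∣ < ε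

InK : (q : ℕ) → Subset q → ℚ → Set
InK q A x = Σ (ℕ → Fin q) λ d → (∀ i → d i ∈ A) × ConvergesTo (partialSum q d) x

module Submission where

-- Write α r ^ k = N / D with N = a s ^ k and D = b t ^ k. If N / D = Σ dᵢ q ^ -i, the remainders
-- R n = q ^ n D (N / D - Sₙ) are integers in [0, D] with R n ≡ N q ^ n (mod D), and the digit
-- dₙ is determined by dₙ D ≤ q R n ≤ (dₙ + 1) D. So it suffices to find n such that N q ^ n
-- mod D lies strictly between c D / q and (c + 1) D / q for a digit c ∉ A. As p ∣ t and p ∤ q,
-- D = p ^ μ G with μ ≥ k and p ∤ G. Choose L with q ^ n₀ (q ^ L - 1) ≡ 0 (mod G), and adjust
-- the exact power of p dividing q ^ L - 1 by lifting the exponent: then the points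
-- N q ^ (n₀ + L j) run modulo D through an arithmetic progression whose step is D / p ^ (g + 1)
-- times a unit modulo p ^ (g + 1). They meet every residue class modulo D / p ^ (g + 1), and
-- once p ^ (g + 1) ≥ 2 q one of these classes has a point in the interval of length D / q.

open import Defs
open import Data.Nat using (ℕ)
open import Data.Nat.Primality using (Prime)

module Arithmetic where

  open import Data.Nat
  open import Data.Nat.Properties
  open import Data.Nat.Divisibility
  open import Data.Nat.DivMod hiding (_mod_)
  open import Data.Nat.Coprimality using (Coprime; coprime-Bézout)
  open import Data.Nat.GCD using (module Bézout)
  open import Data.Nat.Tactic.RingSolver using (solve-∀; solve)
  open import Data.Fin using (Fin; toℕ; fromℕ<)
  open import Data.Fin.Properties using (pigeonhole; toℕ-fromℕ<)
  open import Data.List.Base using (_∷_; [])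
  open import Data.Product using (∃; ∃₂; _×_; _,_)
  open import Data.Sum using (_⊎_; inj₁; inj₂)
  open import Relation.Binary.PropositionalEquality
  open ≡-Reasoning

  infix 4 _≡_mod_

  _≡_mod_ : ℕ → ℕ → ℕ → Set
  x ≡ y mod D = ∃₂ λ a b → x + a * D ≡ y + b * D

  ≡⇒≡-mod : ∀ {x y D} → x ≡ y → x ≡ y mod D
  ≡⇒≡-mod refl = 0 , 0 , refl

  ≡-mod-sym : ∀ {x y D} → x ≡ y mod D → y ≡ x mod D
  ≡-mod-sym (a , b , eq) = b , a , sym eq

  ≡-mod-trans : ∀ {x y z D} → x ≡ y mod D → y ≡ z mod D → x ≡ z mod D
  ≡-mod-trans {x} {y} {z} {D} (a , b , x≡y) (c , d , y≡z) = a + c , d + b , (begin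
    x + (a + c) * D      ≡⟨ solve (x ∷ a ∷ c ∷ D ∷ []) ⟩
    (x + a * D) + c * D  ≡⟨ cong (_+ c * D) x≡y ⟩
    (y + b * D) + c * D  ≡⟨ solve (y ∷ b ∷ c ∷ D ∷ []) ⟩
    (y + c * D) + b * D  ≡⟨ cong (_+ b * D) y≡z ⟩
    (z + d * D) + b * D  ≡⟨ solve (z ∷ d ∷ b ∷ D ∷ []) ⟩
    z + (d + b) * D      ∎)

  m+k*D≡m-mod : ∀ {D} m k → m + k * D ≡ m mod D
  m+k*D≡m-mod m k = 0 , k , +-identityʳ _

  %≡%⇒≡-mod : ∀ {x y D} .{{_ : NonZero D}} → x % D ≡ y % D → x ≡ y mod D
  %≡%⇒≡-mod {x} {y} {D} eq = y / D , x / D , (begin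
    x + y / D * D                  ≡⟨ cong (_+ y / D * D) (m≡m%n+[m/n]*n x D) ⟩
    x % D + x / D * D + y / D * D  ≡⟨ cong (λ r → r + x / D * D + y / D * D) eq ⟩
    y % D + x / D * D + y / D * D  ≡⟨ swap (y % D) (x / D * D) (y / D * D) ⟩
    y % D + y / D * D + x / D * D  ≡⟨ cong (_+ x / D * D) (m≡m%n+[m/n]*n y D) ⟨
    y + x / D * D                  ∎)
    where
    swap : ∀ a b c → a + b + c ≡ a + c + b
    swap = solve-∀

  m+n≡m-mod⇒∣n : ∀ {m n D} → m + n ≡ m mod D → D ∣ n
  m+n≡m-mod⇒∣n {m} {n} {D} (a , b , eq) = ∣m+n∣m⇒∣n (divides b aD+n≡bD) (n∣m*n a)
    where
    aD+n≡bD : a * D + n ≡ b * D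
    aD+n≡bD = +-cancelˡ-≡ m _ _ (begin
      m + (a * D + n)  ≡⟨ cong (m +_) (+-comm (a * D) n) ⟩
      m + (n + a * D)  ≡⟨ +-assoc m n (a * D) ⟨
      m + n + a * D    ≡⟨ eq ⟩
      m + b * D        ∎)

  ≡-mod⇒≡⊎boundary : ∀ {x y D} .{{_ : NonZero D}} → x ≡ y mod D → y < D → x ≤ D →
                      x ≡ y ⊎ (x ≡ D × y ≡ 0)
  ≡-mod⇒≡⊎boundary {x} {y} {D} (a , b , eq) y<D x≤D with m≤n⇒m<n∨m≡n x≤D
  ... | inj₁ x<D = inj₁ (begin
    x                 ≡⟨ m<n⇒m%n≡m x<D ⟨
    x % D             ≡⟨ [m+kn]%n≡m%n x a D ⟨
    (x + a * D) % D   ≡⟨ cong (_% D) eq ⟩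
    (y + b * D) % D   ≡⟨ [m+kn]%n≡m%n y b D ⟩
    y % D             ≡⟨ m<n⇒m%n≡m y<D ⟩
    y                 ∎)
  ... | inj₂ refl = inj₂ (refl , (begin
    y                 ≡⟨ m<n⇒m%n≡m y<D ⟨
    y % D             ≡⟨ [m+kn]%n≡m%n y b D ⟨
    (y + b * D) % D   ≡⟨ cong (_% D) eq ⟨
    (x + a * D) % D   ≡⟨ [m+kn]%n≡m%n x a D ⟩
    x % D             ≡⟨ n%n≡0 x ⟩
    0                 ∎))

  coprime⇒∃inverse : ∀ {c m} → Coprime c m → 1 < m → ∃₂ λ x y → c * x ≡ 1 + y * m
  coprime⇒∃inverse {m = suc zero} _ (s≤s ())
  coprime⇒∃inverse {c} {suc (suc m)} cop _ with coprime-Bézout cop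
  ... | Bézout.+- x y eq = x , y , trans (*-comm c x) (sym eq)
  ... | Bézout.-+ x (suc y) eq = x * suc m , y * suc m + m , +-cancelˡ-≡ (suc m) _ _ (begin
    suc m + c * (x * suc m)                  ≡⟨ solve (c ∷ x ∷ m ∷ []) ⟩
    (1 + x * c) * suc m                      ≡⟨ cong (_* suc m) eq ⟩
    suc y * (2 + m) * suc m                  ≡⟨ solve (y ∷ m ∷ []) ⟩
    suc m + (1 + (y * suc m + m) * (2 + m))  ∎)

  [1+y]^n≡1+y*[n+y*K] : ∀ y n → ∃ λ K → (1 + y) ^ n ≡ 1 + y * (n + y * K)
  [1+y]^n≡1+y*[n+y*K] y zero = 0 , solve (y ∷ [])
  [1+y]^n≡1+y*[n+y*K] y (suc n) with [1+y]^n≡1+y*[n+y*K] y n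
  ... | K , eq = K + n + y * K , (begin
    (1 + y) * (1 + y) ^ n                  ≡⟨ cong ((1 + y) *_) eq ⟩
    (1 + y) * (1 + y * (n + y * K))        ≡⟨ solve (y ∷ n ∷ K ∷ []) ⟩
    1 + y * (suc n + y * (K + n + y * K))  ∎)

  ^-repeats-mod : ∀ q M .{{_ : NonZero M}} → ∃₂ λ i h → q ^ i ≡ q ^ (i + suc h) mod M
  ^-repeats-mod q M with pigeonhole (n<1+n M) (λ (i : Fin (suc M)) → fromℕ< (m%n<n (q ^ toℕ i) M))
  ... | i , j , i<j , eq with m≤n⇒∃[o]m+o≡n i<j
  ... | h , i+1+h≡j = toℕ i , h , %≡%⇒≡-mod (begin
    q ^ toℕ i % M                               ≡⟨ toℕ-fromℕ< _ ⟨
    toℕ (fromℕ< (m%n<n (q ^ toℕ i) M))          ≡⟨ cong toℕ eq ⟩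
    toℕ (fromℕ< (m%n<n (q ^ toℕ j) M))          ≡⟨ toℕ-fromℕ< _ ⟩
    q ^ toℕ j % M                               ≡⟨ cong (λ n → q ^ n % M) (trans (+-suc (toℕ i) h) i+1+h≡j) ⟨
    q ^ (toℕ i + suc h) % M                     ∎)

  q^L≡1+Y⇒q^i≡q^[i+L]⇒∣q^i*Y : ∀ {q L Y M} i → q ^ L ≡ 1 + Y → q ^ i ≡ q ^ (i + L) mod M → M ∣ q ^ i * Y
  q^L≡1+Y⇒q^i≡q^[i+L]⇒∣q^i*Y {q} {L} {Y} i q^L≡1+Y q^i≡q^[i+L] =
    m+n≡m-mod⇒∣n (≡-mod-trans (≡⇒≡-mod q^i+q^i*Y≡q^[i+L]) (≡-mod-sym q^i≡q^[i+L]))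
    where
    q^i+q^i*Y≡q^[i+L] : q ^ i + q ^ i * Y ≡ q ^ (i + L)
    q^i+q^i*Y≡q^[i+L] = begin
      q ^ i + q ^ i * Y  ≡⟨ cong (q ^ i +_) (*-comm (q ^ i) Y) ⟩
      (1 + Y) * q ^ i    ≡⟨ cong (_* q ^ i) q^L≡1+Y ⟨
      q ^ L * q ^ i      ≡⟨ *-comm (q ^ L) (q ^ i) ⟩
      q ^ i * q ^ L      ≡⟨ ^-distribˡ-+-* q i L ⟨
      q ^ (i + L)        ∎

  ^-monoʳ-∣ : ∀ a {m n} → m ≤ n → a ^ m ∣ a ^ n
  ^-monoʳ-∣ a {m} m≤n with m≤n⇒∃[o]m+o≡n m≤n
  ... | o , refl = divides (a ^ o) (trans (^-distribˡ-+-* a m o) (*-comm (a ^ m) (a ^ o)))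

  ^-distribʳ-* : ∀ m n k → (m * n) ^ k ≡ m ^ k * n ^ k
  ^-distribʳ-* m n zero    = refl
  ^-distribʳ-* m n (suc k) = begin
    m * n * (m * n) ^ k        ≡⟨ cong (m * n *_) (^-distribʳ-* m n k) ⟩
    m * n * (m ^ k * n ^ k)    ≡⟨ [m*n]*[o*p]≡[m*o]*[n*p] m n (m ^ k) (n ^ k) ⟩
    m * m ^ k * (n * n ^ k)    ∎

module PrimePowers {p : ℕ} (p-prime : Prime p) where

  open import Data.Nat
  open import Data.Nat.Properties
  open import Data.Nat.Divisibility
  open import Data.Nat.Primality using (prime⇒nonZero; prime⇒nonTrivial; prime⇒irreducible; euclidsLemma)
  open import Data.Nat.Coprimality using (Coprime; coprime-divisor; gcd≡1⇒coprime) renaming (sym to coprime-sym)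
  open import Data.Nat.GCD using (gcd[m,n]∣m; gcd[m,n]∣n)
  open import Data.Nat.Induction using (<-wellFounded)
  open import Induction.WellFounded using (Acc; acc)
  open import Data.Product using (∃₂; _×_; _,_)
  open import Data.Sum using (_⊎_; inj₁; inj₂; [_,_]′)
  open import Relation.Nullary using (¬_; yes; no; contradiction)
  open import Relation.Binary.PropositionalEquality
  open Arithmetic using (coprime⇒∃inverse)

  instance
    p≢0 : NonZero p
    p≢0 = prime⇒nonZero p-prime

  1<p : 1 < p
  1<p = nonTrivial⇒n>1 p {{prime⇒nonTrivial p-prime}}

  ∤1 : ¬ p ∣ 1
  ∤1 p∣1 = <⇒≢ 1<p (sym (∣1⇒≡1 p∣1))

  ∤-* : ∀ {m n} → ¬ p ∣ m → ¬ p ∣ n → ¬ p ∣ m * n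
  ∤-* {m} {n} p∤m p∤n p∣mn = [ p∤m , p∤n ]′ (euclidsLemma m n p-prime p∣mn)

  ∤-^ : ∀ {m} n → ¬ p ∣ m → ¬ p ∣ m ^ n
  ∤-^ zero    p∤m = ∤1
  ∤-^ (suc n) p∤m = ∤-* p∤m (∤-^ n p∤m)

  ∣p^⇒≡1⊎p∣ : ∀ {d} g → d ∣ p ^ g → d ≡ 1 ⊎ p ∣ d
  ∣p^⇒≡1⊎p∣ zero d∣1 = inj₁ (∣1⇒≡1 d∣1)
  ∣p^⇒≡1⊎p∣ {d} (suc g) d∣p^g with prime⇒irreducible p-prime (gcd[m,n]∣n d p)
  ... | inj₂ gcd≡p = inj₂ (subst (_∣ d) gcd≡p (gcd[m,n]∣m d p))
  ... | inj₁ gcd≡1 = ∣p^⇒≡1⊎p∣ g (coprime-divisor (gcd≡1⇒coprime gcd≡1) d∣p^g)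

  ∤⇒coprime-p^ : ∀ {m} g → ¬ p ∣ m → Coprime m (p ^ g)
  ∤⇒coprime-p^ g p∤m (d∣m , d∣p^g) with ∣p^⇒≡1⊎p∣ g d∣p^g
  ... | inj₁ d≡1 = d≡1
  ... | inj₂ p∣d = contradiction (∣-trans p∣d d∣m) p∤m

  ∤⇒p^∣*⇒p^∣ : ∀ {m n} f → ¬ p ∣ m → p ^ f ∣ m * n → p ^ f ∣ n
  ∤⇒p^∣*⇒p^∣ f p∤m = coprime-divisor (coprime-sym (∤⇒coprime-p^ f p∤m))

  ∤⇒∃inverse-mod-p^ : ∀ {c} g → ¬ p ∣ c → ∃₂ λ x y → c * x ≡ 1 + y * p ^ suc g
  ∤⇒∃inverse-mod-p^ g p∤c =
    coprime⇒∃inverse (∤⇒coprime-p^ (suc g) p∤c) (≤-trans 1<p (m≤m*n p (p ^ g) {{m^n≢0 p g}}))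

  p-adic-split : ∀ n → .{{NonZero n}} → ∃₂ λ v m → n ≡ p ^ v * m × ¬ p ∣ m
  p-adic-split n = split n (<-wellFounded n)
    where
    split : ∀ n → .{{NonZero n}} → Acc _<_ n → ∃₂ λ v m → n ≡ p ^ v * m × ¬ p ∣ m
    split n (acc rec) with p ∣? n
    ... | no p∤n = 0 , n , sym (+-identityʳ n) , p∤n
    ... | yes (divides m@(suc _) refl) with split m (rec (m<m*n m p 1<p))
    ...   | v , k , m≡p^v*k , p∤k = suc v , k , (begin
      m * p             ≡⟨ cong (_* p) m≡p^v*k ⟩
      p ^ v * k * p     ≡⟨ *-comm (p ^ v * k) p ⟩
      p * (p ^ v * k)   ≡⟨ *-assoc p (p ^ v) k ⟨
      p * p ^ v * k     ∎) , p∤k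
      where open ≡-Reasoning

  p∣⇒p-adic-split : ∀ {n} .{{_ : NonZero n}} → p ∣ n → ∃₂ λ v m → n ≡ p ^ suc v * m × ¬ p ∣ m
  p∣⇒p-adic-split {n} p∣n with p-adic-split n
  ... | zero  , m , n≡m , p∤m = contradiction (subst (p ∣_) (trans n≡m (*-identityˡ m)) p∣n) p∤m
  ... | suc v , m , n≡p^[1+v]m , p∤m = v , m , n≡p^[1+v]m , p∤m

  coprime∧p∣⇒p∤ : ∀ {m n} → Coprime m n → p ∣ n → ¬ p ∣ m
  coprime∧p∣⇒p∤ cop p∣n p∣m = <⇒≢ 1<p (sym (cop (p∣m , p∣n)))

  n<p^n : ∀ n → n < p ^ n
  n<p^n zero    = s≤s z≤n
  n<p^n (suc n) = begin-strict
    suc n       ≤⟨ n<p^n n ⟩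
    p ^ n       <⟨ m<m*n (p ^ n) p 1<p ⟩
    p ^ n * p   ≡⟨ *-comm (p ^ n) p ⟩
    p ^ suc n   ∎
    where
    open ≤-Reasoning
    instance
      p^n≢0 : NonZero (p ^ n)
      p^n≢0 = m^n≢0 p n

  2*n≤p^[1+n] : ∀ n → 2 * n ≤ p ^ suc n
  2*n≤p^[1+n] n = *-mono-≤ 1<p (<⇒≤ (n<p^n n))

  ∤⇒≢0 : ∀ {m} → ¬ p ∣ m → NonZero m
  ∤⇒≢0 {m} p∤m = ≢-nonZero λ m≡0 → p∤m (subst (p ∣_) (sym m≡0) (p ∣0))

module Periods where

  open import Data.Nat
  open import Data.Nat.Properties
  open import Data.Nat.Divisibility
  open import Data.Nat.Primality using (Prime)
  open import Data.Nat.Tactic.RingSolver using (solve-∀)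
  open import Data.Product using (∃; _,_)
  open import Relation.Nullary using (¬_)
  open import Relation.Binary.PropositionalEquality
  open ≡-Reasoning
  open Arithmetic

  -- n ↦ q ^ n is periodic modulo G from n₀ on, with period L, and p ^ e exactly divides q ^ L - 1.
  record Period (p q G e : ℕ) : Set where
    field
      L n₀ Y u : ℕ
      q^L≡1+Y  : q ^ L ≡ 1 + Y
      G∣q^n₀*Y : G ∣ q ^ n₀ * Y
      Y≡p^e*u  : Y ≡ p ^ e * u
      p∤u      : ¬ p ∣ u

  q^L≡1+Y⇒q^[L*m]≡1+Y*[m+Y*K] : ∀ q L {Y} m → q ^ L ≡ 1 + Y → ∃ λ K → q ^ (L * m) ≡ 1 + Y * (m + Y * K)
  q^L≡1+Y⇒q^[L*m]≡1+Y*[m+Y*K] q L {Y} m q^L≡1+Y with [1+y]^n≡1+y*[n+y*K] Y m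
  ... | K , eq = K , (begin
    q ^ (L * m)  ≡⟨ ^-*-assoc q L m ⟨
    (q ^ L) ^ m  ≡⟨ cong (_^ m) q^L≡1+Y ⟩
    (1 + Y) ^ m  ≡⟨ eq ⟩
    1 + Y * (m + Y * K) ∎)

  Period-resp-∣ : ∀ {p q G H e} → H ∣ G → Period p q G e → Period p q H e
  Period-resp-∣ H∣G per = record
    { L = L ; n₀ = n₀ ; Y = Y ; u = u
    ; q^L≡1+Y = q^L≡1+Y
    ; G∣q^n₀*Y = ∣-trans H∣G G∣q^n₀*Y
    ; Y≡p^e*u = Y≡p^e*u
    ; p∤u = p∤u
    }
    where open Period per

  module _ {p : ℕ} (p-prime : Prime p) where
    open PrimePowers p-prime

    Period-* : ∀ {q G τ e} → τ ∣ G → ¬ p ∣ τ → Period p q G (suc e) → Period p q (G * τ) (suc e)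
    Period-* {q} {G} {τ} {e} τ∣G p∤τ per
      with q^L≡1+Y⇒q^[L*m]≡1+Y*[m+Y*K] q (Period.L per) τ (Period.q^L≡1+Y per)
    ... | K , q^Lτ≡ = record
      { L = L * τ ; n₀ = n₀ + n₀ ; Y = Y * S ; u = u * S
      ; q^L≡1+Y = q^Lτ≡
      ; G∣q^n₀*Y = subst (G * τ ∣_) rearrange (*-pres-∣ G∣q^n₀*Y τ∣Q*S)
      ; Y≡p^e*u = trans (cong (_* S) Y≡p^e*u) (*-assoc (p ^ suc e) u S)
      ; p∤u = ∤-* p∤u p∤S
      }
      where
      open Period per
      S = τ + Y * K
      Q = q ^ n₀
      τ∣Q*S : τ ∣ Q * τ + (Q * Y) * K
      τ∣Q*S = ∣m∣n⇒∣m+n (n∣m*n Q) (∣m⇒∣m*n K (∣-trans τ∣G G∣q^n₀*Y))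
      rearrange : (Q * Y) * (Q * τ + (Q * Y) * K) ≡ q ^ (n₀ + n₀) * (Y * S)
      rearrange = trans (factor Q Y τ K) (cong (_* (Y * S)) (sym (^-distribˡ-+-* q n₀ n₀)))
        where
        factor : ∀ Q Y τ K → (Q * Y) * (Q * τ + (Q * Y) * K) ≡ Q * Q * (Y * (τ + Y * K))
        factor = solve-∀
      p∣Y : p ∣ Y
      p∣Y = ∣-trans (m∣m*n (p ^ e)) (subst (p ^ suc e ∣_) (sym Y≡p^e*u) (m∣m*n u))
      p∤S : ¬ p ∣ S
      p∤S p∣S = p∤τ (∣m+n∣m⇒∣n (subst (p ∣_) (+-comm τ (Y * K)) p∣S) (∣m⇒∣m*n K p∣Y))

    Period-*^ : ∀ {q G τ e} → τ ∣ G → ¬ p ∣ τ → Period p q G (suc e) → ∀ j → Period p q (G * τ ^ j) (suc e)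
    Period-*^ {G = G} τ∣G p∤τ per zero = Period-resp-∣ (∣-reflexive (*-identityʳ G)) per
    Period-*^ {G = G} {τ} τ∣G p∤τ per (suc j) =
      Period-resp-∣ (∣-reflexive (sym (trans (*-assoc G (τ ^ j) τ) (cong (G *_) (*-comm (τ ^ j) τ)))))
        (Period-* (∣-trans τ∣G (m∣m*n (τ ^ j))) p∤τ (Period-*^ τ∣G p∤τ per j))

    -- Lifting the exponent: raising q ^ L to the p-th power adds exactly one factor p to q ^ L - 1;
    -- the exponent 2 + f ≥ 2 makes this work for p = 2 as well.
    Period-suc : ∀ {q G f} → Period p q G (2 + f) → Period p q G (3 + f)
    Period-suc {q} {G} {f} per
      with q^L≡1+Y⇒q^[L*m]≡1+Y*[m+Y*K] q (Period.L per) p (Period.q^L≡1+Y per)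
    ... | K , q^Lp≡ = record
      { L = L * p ; n₀ = n₀ ; Y = Y * (p + Y * K) ; u = u * (1 + p ^ suc f * u * K)
      ; q^L≡1+Y = q^Lp≡
      ; G∣q^n₀*Y = ∣-trans G∣q^n₀*Y (subst (q ^ n₀ * Y ∣_) (*-assoc (q ^ n₀) Y _) (m∣m*n _))
      ; Y≡p^e*u = trans (cong (λ Y → Y * (p + Y * K)) Y≡p^e*u) (expand p (p ^ f) u K)
      ; p∤u = ∤-* p∤u p∤1+p^f*u*K
      }
      where
      open Period per
      expand : ∀ p P u K → p * (p * P) * u * (p + p * (p * P) * u * K)
                         ≡ p * (p * (p * P)) * (u * (1 + p * P * u * K))
      expand = solve-∀
      p∤1+p^f*u*K : ¬ p ∣ 1 + p ^ suc f * u * K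
      p∤1+p^f*u*K p∣ = ∤1 (∣m+n∣m⇒∣n (subst (p ∣_) (+-comm 1 _) p∣)
                                      (∣m⇒∣m*n K (∣m⇒∣m*n u (m∣m*n (p ^ f)))))

    Period-+ : ∀ {q G e} l → Period p q G (2 + e) → Period p q G (2 + (l + e))
    Period-+ zero    per = per
    Period-+ (suc l) per = Period-suc (Period-+ l per)

    ∃Period : ∀ {q G} → 2 ≤ q → ¬ p ∣ q → ¬ p ∣ G → ∃ λ e → Period p q (p ^ 2 * G) (2 + e)
    ∃Period {1} (s≤s ())
    ∃Period {q@(suc (suc q-2))} {G} _ p∤q p∤G
      with ^-repeats-mod q (p ^ 2 * G) {{m*n≢0 (p ^ 2) G {{m^n≢0 p 2}} {{∤⇒≢0 p∤G}}}}
    ... | i , h , q^i≡q^[i+1+h] with m≤n⇒∃[o]m+o≡n (m≤m*n q (q ^ h) {{m^n≢0 q h}})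
    ... | k , q+k≡q^[1+h] with q^L≡1+Y⇒q^i≡q^[i+L]⇒∣q^i*Y i (sym q+k≡q^[1+h]) q^i≡q^[i+1+h]
    ... | M∣q^i*Y with ∤⇒p^∣*⇒p^∣ 2 (∤-^ i p∤q) (∣-trans (m∣m*n G) M∣q^i*Y)
    ... | divides Z@(suc _) Y≡Z*p^2 with p-adic-split Z
    ... | e , u , Z≡p^e*u , p∤u = e , record
      { L = suc h ; n₀ = i ; Y = suc (q-2 + k) ; u = u   -- q ^ (1 + h) - 1 = (q - 1) + k
      ; q^L≡1+Y = sym q+k≡q^[1+h]
      ; G∣q^n₀*Y = M∣q^i*Y
      ; Y≡p^e*u = trans Y≡Z*p^2 (trans (cong (_* p ^ 2) Z≡p^e*u) (rearrange p (p ^ e) u))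
      ; p∤u = p∤u
      }
      where
      rearrange : ∀ p P u → P * u * (p * (p * 1)) ≡ p * (p * P) * u
      rearrange = solve-∀

module Orbits where

  open import Data.Nat
  open import Data.Nat.Properties
  open import Data.Nat.Divisibility
  open import Data.Nat.DivMod hiding (_mod_)
  open import Data.Nat.Primality using (Prime)
  open import Data.Nat.Tactic.RingSolver using (solve-∀; solve)
  open import Data.List.Base using (_∷_; [])
  open import Algebra.Properties.CommutativeSemigroup *-commutativeSemigroup using (x∙yz≈xz∙y; xy∙z≈xz∙y)
  open import Data.Product using (∃; ∃₂; _×_; _,_)
  open import Relation.Nullary using (¬_)
  open import Relation.Binary.PropositionalEquality
  open Arithmetic
  open Periods

  OrbitMeetsInterval : (q N D c : ℕ) → Set
  OrbitMeetsInterval q N D c = ∃₂ λ n v → N * q ^ n ≡ v mod D × c * D < q * v × q * v < suc c * D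

  orbit-progression : ∀ {q L Y D} r j → q ^ L ≡ 1 + Y → D ∣ r * Y * Y → r * q ^ (L * j) ≡ r + j * (r * Y) mod D
  orbit-progression {q} {L} {Y} {D} r j q^L≡1+Y (divides k rYY≡kD)
    with q^L≡1+Y⇒q^[L*m]≡1+Y*[m+Y*K] q L j q^L≡1+Y
  ... | K , q^Lj≡1+Y*[j+Y*K] = ≡-mod-trans (≡⇒≡-mod (begin
    r * q ^ (L * j)                   ≡⟨ cong (r *_) q^Lj≡1+Y*[j+Y*K] ⟩
    r * (1 + Y * (j + Y * K))         ≡⟨ solve (r ∷ Y ∷ j ∷ K ∷ []) ⟩
    r + j * (r * Y) + r * Y * Y * K   ≡⟨ cong (λ x → r + j * (r * Y) + x * K) rYY≡kD ⟩
    r + j * (r * Y) + k * D * K       ≡⟨ cong (r + j * (r * Y) +_) (xy∙z≈xz∙y k D K) ⟩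
    r + j * (r * Y) + k * K * D       ∎)) (m+k*D≡m-mod _ (k * K))
    where open ≡-Reasoning

  progression-meets-residue : ∀ {E P c} .{{_ : NonZero E}} → 1 ≤ P → (∃₂ λ x y → c * x ≡ 1 + y * P) →
                              ∀ r i → ∃ λ j → r + j * (E * c) ≡ r % E + E * i mod (E * P)
  progression-meets-residue {E} {suc P-1} {c} _ (x , y , cx≡1+yP) r i = x * T , ≡-mod-trans (≡⇒≡-mod (begin
    r + x * T * (E * c)                        ≡⟨ cong (_+ x * T * (E * c)) (m≡m%n+[m/n]*n r E) ⟩
    r % E + r / E * E + x * T * (E * c)        ≡⟨ cong (r % E + r / E * E +_) (regroup x T E c) ⟩
    r % E + r / E * E + c * x * T * E          ≡⟨ cong (λ z → r % E + r / E * E + z * T * E) cx≡1+yP ⟩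
    r % E + r / E * E + (1 + y * suc P-1) * T * E ≡⟨ collect (r % E) (r / E) E y P-1 i ⟩
    r % E + E * i + (r / E + T * y) * (E * suc P-1) ∎)) (m+k*D≡m-mod _ (r / E + T * y))
    where
    open ≡-Reasoning
    -- Chosen so that r / E + T ≡ i modulo P.
    T = i + P-1 * (r / E)
    regroup : ∀ x T E c → x * T * (E * c) ≡ c * x * T * E
    regroup = solve-∀
    collect : ∀ ρ f E y P-1 i → ρ + f * E + (1 + y * suc P-1) * (i + P-1 * f) * E
                             ≡ ρ + E * i + (f + (i + P-1 * f) * y) * (E * suc P-1)
    collect = solve-∀

  between-multiples : ∀ {q P} .{{_ : NonZero q}} c → 2 * q ≤ P → ∃ λ i → c * P < q * i × q * suc i ≤ suc c * P
  between-multiples {q} {P} c 2q≤P = suc a , cP<q[1+a] , q[2+a]≤[1+c]P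
    where
    open ≤-Reasoning
    a = c * P / q
    cP<q[1+a] : c * P < q * suc a
    cP<q[1+a] = begin-strict
      c * P                  ≡⟨ m≡m%n+[m/n]*n (c * P) q ⟩
      c * P % q + a * q      <⟨ +-monoˡ-< (a * q) (m%n<n (c * P) q) ⟩
      q + a * q              ≡⟨ cong (q +_) (*-comm a q) ⟩
      q + q * a              ≡⟨ *-suc q a ⟨
      q * suc a              ∎
    q[2+a]≤[1+c]P : q * suc (suc a) ≤ suc c * P
    q[2+a]≤[1+c]P = begin
      q * suc (suc a)        ≡⟨ *-comm q (suc (suc a)) ⟩
      q + (q + a * q)        ≡⟨ +-comm q (q + a * q) ⟩
      q + a * q + q          ≡⟨ cong (_+ q) (+-comm q (a * q)) ⟩
      a * q + q + q          ≡⟨ +-assoc (a * q) q q ⟩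
      a * q + (q + q)        ≡⟨ cong (λ x → a * q + (q + x)) (+-identityʳ q) ⟨
      a * q + 2 * q          ≤⟨ +-mono-≤ (m/n*n≤m (c * P) q) 2q≤P ⟩
      c * P + P              ≡⟨ +-comm (c * P) P ⟩
      suc c * P              ∎

  residue-class-meets-interval : ∀ {q E P} .{{_ : NonZero q}} c ρ → ρ < E → 2 * q ≤ P →
    ∃ λ i → c * (E * P) < q * (ρ + E * i) × q * (ρ + E * i) < suc c * (E * P)
  residue-class-meets-interval {q} {E} {P} c ρ ρ<E 2q≤P with between-multiples c 2q≤P
  ... | i , cP<qi , q[1+i]≤[1+c]P = i , lower , upper
    where
    open ≤-Reasoning
    instance
      E≢0 : NonZero E
      E≢0 = >-nonZero (≤-<-trans z≤n ρ<E)
    lower : c * (E * P) < q * (ρ + E * i)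
    lower = begin-strict
      c * (E * P)            ≡⟨ solve (c ∷ E ∷ P ∷ []) ⟩
      E * (c * P)            <⟨ *-monoʳ-< E cP<qi ⟩
      E * (q * i)            ≤⟨ m≤n+m (E * (q * i)) (q * ρ) ⟩
      q * ρ + E * (q * i)    ≡⟨ solve (q ∷ ρ ∷ E ∷ i ∷ []) ⟩
      q * (ρ + E * i)        ∎
    upper : q * (ρ + E * i) < suc c * (E * P)
    upper = begin-strict
      q * (ρ + E * i)        ≡⟨ solve (q ∷ ρ ∷ E ∷ i ∷ []) ⟩
      q * ρ + E * (q * i)    <⟨ +-monoˡ-< (E * (q * i)) (*-monoʳ-< q ρ<E) ⟩
      q * E + E * (q * i)    ≡⟨ solve (q ∷ E ∷ i ∷ []) ⟩
      E * (q * suc i)        ≤⟨ *-monoʳ-≤ E q[1+i]≤[1+c]P ⟩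
      E * (suc c * P)        ≡⟨ solve (c ∷ E ∷ P ∷ []) ⟩
      suc c * (E * P)        ∎

  orbit-along-period : ∀ {p q G e N E w P} (per : Period p q G e) → let open Period per in
    N * q ^ n₀ * Y ≡ E * w → P ∣ Y → ∀ j → N * q ^ (n₀ + L * j) ≡ N * q ^ n₀ + j * (E * w) mod (E * P)
  orbit-along-period {q = q} {N = N} {E} {w} {P} per NQY≡Ew P∣Y j =
    subst₂ (_≡_mod (E * P)) Nq^[n₀+Lj]≡ (cong (λ x → r + j * x) NQY≡Ew)
      (orbit-progression {q} {L} r j q^L≡1+Y (subst (E * P ∣_) rYY≡EwY (*-monoʳ-∣ E (∣n⇒∣m*n w P∣Y))))
    where
    open Period per
    open ≡-Reasoning
    r = N * q ^ n₀
    rYY≡EwY : E * (w * Y) ≡ r * Y * Y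
    rYY≡EwY = trans (sym (*-assoc E w Y)) (cong (_* Y) (sym NQY≡Ew))
    Nq^[n₀+Lj]≡ : r * q ^ (L * j) ≡ N * q ^ (n₀ + L * j)
    Nq^[n₀+Lj]≡ = trans (*-assoc N (q ^ n₀) (q ^ (L * j))) (cong (N *_) (sym (^-distribˡ-+-* q n₀ (L * j))))

  module _ {p : ℕ} (p-prime : Prime p) where
    open PrimePowers p-prime

    N*q^n₀*Y≡p^[f+δ]*G*w : ∀ {q G N δ N' f} → ¬ p ∣ q → ¬ p ∣ G → N ≡ p ^ δ * N' → ¬ p ∣ N' →
      (per : Period p q G f) → let open Period per in
      ∃ λ w → ¬ p ∣ w × N * q ^ n₀ * Y ≡ p ^ (f + δ) * G * w
    N*q^n₀*Y≡p^[f+δ]*G*w {q} {G} {N} {δ} {N'} {f} p∤q p∤G refl p∤N' per = N' * W , ∤-* p∤N' p∤W , (begin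
      p ^ δ * N' * Q * Y         ≡⟨ *-assoc (p ^ δ * N') Q Y ⟩
      p ^ δ * N' * (Q * Y)       ≡⟨ cong (p ^ δ * N' *_) QY≡VG ⟩
      p ^ δ * N' * (V * G)       ≡⟨ cong (λ x → p ^ δ * N' * (x * G)) V≡Wp^f ⟩
      p ^ δ * N' * (W * p ^ f * G) ≡⟨ rearrange (p ^ δ) N' W (p ^ f) G ⟩
      p ^ f * p ^ δ * G * (N' * W) ≡⟨ cong (λ x → x * G * (N' * W)) (^-distribˡ-+-* p f δ) ⟨
      p ^ (f + δ) * G * (N' * W) ∎)
      where
      open Period per
      open ≡-Reasoning
      rearrange : ∀ D N W F G → D * N * (W * F * G) ≡ F * D * G * (N * W)
      rearrange = solve-∀
      Q = q ^ n₀
      V = quotient G∣q^n₀*Y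
      QY≡VG : Q * Y ≡ V * G
      QY≡VG = _∣_.equality G∣q^n₀*Y
      GV≡Qup^f : G * V ≡ Q * u * p ^ f
      GV≡Qup^f = begin
        G * V           ≡⟨ *-comm G V ⟩
        V * G           ≡⟨ QY≡VG ⟨
        Q * Y           ≡⟨ cong (Q *_) Y≡p^e*u ⟩
        Q * (p ^ f * u) ≡⟨ x∙yz≈xz∙y Q (p ^ f) u ⟩
        Q * u * p ^ f   ∎
      p^f∣V : p ^ f ∣ V
      p^f∣V = ∤⇒p^∣*⇒p^∣ f p∤G (divides (Q * u) GV≡Qup^f)
      W = quotient p^f∣V
      V≡Wp^f : V ≡ W * p ^ f
      V≡Wp^f = _∣_.equality p^f∣V
      GW≡Qu : G * W ≡ Q * u
      GW≡Qu = *-cancelʳ-≡ (G * W) (Q * u) (p ^ f) {{m^n≢0 p f}} (begin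
        G * W * p ^ f   ≡⟨ *-assoc G W (p ^ f) ⟩
        G * (W * p ^ f) ≡⟨ cong (G *_) V≡Wp^f ⟨
        G * V           ≡⟨ GV≡Qup^f ⟩
        Q * u * p ^ f   ∎)
      p∤W : ¬ p ∣ W
      p∤W p∣W = ∤-* (∤-^ n₀ p∤q) p∤u (subst (p ∣_) GW≡Qu (∣n⇒∣m*n G p∣W))

    -- Along n₀ + L j the orbit is the progression r + j E w modulo D = E P with w a unit modulo P.
    orbit-meets-interval : ∀ {q G N δ N' f g} .{{_ : NonZero q}} c → ¬ p ∣ q → ¬ p ∣ G →
      N ≡ p ^ δ * N' → ¬ p ∣ N' → Period p q G f → suc g ≤ f → 2 * q ≤ p ^ suc g →
      OrbitMeetsInterval q N (p ^ (f + δ) * G * p ^ suc g) c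
    orbit-meets-interval {q} {G} {N} {δ} {N'} {f} {g} c p∤q p∤G N≡p^δN' p∤N' per g<f 2q≤P =
      let (w , p∤w , NQY≡Ew) = N*q^n₀*Y≡p^[f+δ]*G*w p∤q p∤G N≡p^δN' p∤N' per
          (i , lower , upper) = residue-class-meets-interval c (r % E) (m%n<n r E) 2q≤P
          (j , r+jEw≡v) = progression-meets-residue {E} {P} 1≤P (∤⇒∃inverse-mod-p^ g p∤w) r i
      in n₀ + L * j , r % E + E * i ,
         ≡-mod-trans (orbit-along-period {N = N} {E} per NQY≡Ew P∣Y j) r+jEw≡v , lower , upper
      where
      open Period per
      E = p ^ (f + δ) * G
      P = p ^ suc g
      r = N * q ^ n₀
      instance
        E≢0 : NonZero E
        E≢0 = m*n≢0 (p ^ (f + δ)) G {{m^n≢0 p (f + δ)}} {{∤⇒≢0 p∤G}}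
      1≤P : 1 ≤ P
      1≤P = m^n>0 p (suc g)
      P∣Y : P ∣ Y
      P∣Y = ∣-trans (^-monoʳ-∣ p g<f) (divides u (trans Y≡p^e*u (*-comm (p ^ f) u)))

module Expansions where

  open import Data.Nat as ℕ using (ℕ; zero; suc; z≤n; s≤s)
  import Data.Nat.Properties as ℕ
  open import Algebra.Properties.CommutativeSemigroup ℕ.*-commutativeSemigroup
    using () renaming (x∙yz≈y∙xz to ℕ-x∙yz≈y∙xz)
  open import Data.Integer as ℤ using (+_)
  import Data.Integer.Properties as ℤ
  open import Data.Integer.Tactic.RingSolver using (solve-∀)
  open import Data.Nat.Tactic.RingSolver using () renaming (solve-∀ to ℕ-solve-∀)
  open Arithmetic using (_≡_mod_)
  open import Data.Rational
  open import Data.Rational.Properties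
  open import Algebra.Bundles using (CommutativeMonoid)
  open import Algebra.Properties.CommutativeSemigroup (CommutativeMonoid.commutativeSemigroup *-1-commutativeMonoid)
    using (interchange; x∙yz≈y∙xz)
  import Data.Rational.Unnormalised as ℚᵘ
  import Data.Rational.Unnormalised.Properties as ℚᵘ
  open import Data.Rational.Solver using (module +-*-Solver)
  open import Data.Fin using (Fin; toℕ)
  open import Data.Fin.Properties using (toℕ<n)
  open import Data.Product using (_,_)
  open import Data.Sum using (inj₁; inj₂)
  open import Relation.Nullary using (¬_; yes; no; contradiction)
  open import Relation.Binary.PropositionalEquality
  import Relation.Binary.Reasoning.Setoid as SetoidReasoning

  ι : ℕ → ℚ
  ι n = + n / 1

  private
    toℚᵘ-ι : ∀ n → toℚᵘ (ι n) ℚᵘ.≃ ℚᵘ.mkℚᵘ (+ n) 0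
    toℚᵘ-ι n = toℚᵘ-fromℚᵘ (ℚᵘ.mkℚᵘ (+ n) 0)

  ι-+ : ∀ m n → ι (m ℕ.+ n) ≡ ι m + ι n
  ι-+ m n = toℚᵘ-injective (begin
    toℚᵘ (ι (m ℕ.+ n))                  ≈⟨ toℚᵘ-ι (m ℕ.+ n) ⟩
    ℚᵘ.mkℚᵘ (+ (m ℕ.+ n)) 0             ≈⟨ ℚᵘ.*≡* (trans (cong (ℤ._* + 1) (ℤ.pos-+ m n)) (ℤ-eq (+ m) (+ n))) ⟩
    ℚᵘ.mkℚᵘ (+ m) 0 ℚᵘ.+ ℚᵘ.mkℚᵘ (+ n) 0 ≈⟨ ℚᵘ.+-cong (toℚᵘ-ι m) (toℚᵘ-ι n) ⟨
    toℚᵘ (ι m) ℚᵘ.+ toℚᵘ (ι n)          ≈⟨ toℚᵘ-homo-+ (ι m) (ι n) ⟨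
    toℚᵘ (ι m + ι n)                    ∎)
    where
    open SetoidReasoning ℚᵘ.≃-setoid
    ℤ-eq : ∀ i j → (i ℤ.+ j) ℤ.* + 1 ≡ (i ℤ.* + 1 ℤ.+ j ℤ.* + 1) ℤ.* + 1
    ℤ-eq = solve-∀

  ι-* : ∀ m n → ι (m ℕ.* n) ≡ ι m * ι n
  ι-* m n = toℚᵘ-injective (begin
    toℚᵘ (ι (m ℕ.* n))                  ≈⟨ toℚᵘ-ι (m ℕ.* n) ⟩
    ℚᵘ.mkℚᵘ (+ (m ℕ.* n)) 0             ≈⟨ ℚᵘ.*≡* (cong (ℤ._* + 1) (ℤ.pos-* m n)) ⟩
    ℚᵘ.mkℚᵘ (+ m) 0 ℚᵘ.* ℚᵘ.mkℚᵘ (+ n) 0 ≈⟨ ℚᵘ.*-cong (toℚᵘ-ι m) (toℚᵘ-ι n) ⟨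
    toℚᵘ (ι m) ℚᵘ.* toℚᵘ (ι n)          ≈⟨ toℚᵘ-homo-* (ι m) (ι n) ⟨
    toℚᵘ (ι m * ι n)                    ∎)
    where open SetoidReasoning ℚᵘ.≃-setoid

  ι-cancel-≤ : ∀ {m n} → ι m ≤ ι n → m ℕ.≤ n
  ι-cancel-≤ {m} {n} ιm≤ιn
    with ℚᵘ.≤-respʳ-≃ (toℚᵘ-ι n) (ℚᵘ.≤-respˡ-≃ (toℚᵘ-ι m) (toℚᵘ-mono-≤ ιm≤ιn))
  ... | ℚᵘ.*≤* m*1≤n*1 = ℤ.drop‿+≤+ (subst₂ ℤ._≤_ (ℤ.*-identityʳ (+ m)) (ℤ.*-identityʳ (+ n)) m*1≤n*1)

  /-*-ι : ∀ i n .{{_ : ℕ.NonZero n}} → (i / n) * ι n ≡ i / 1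
  /-*-ι i n@(suc m) = toℚᵘ-injective (begin
    toℚᵘ (i / n * ι n)                     ≈⟨ toℚᵘ-homo-* (i / n) (ι n) ⟩
    toℚᵘ (i / n) ℚᵘ.* toℚᵘ (ι n)           ≈⟨ ℚᵘ.*-cong (toℚᵘ-fromℚᵘ (ℚᵘ.mkℚᵘ i m)) (toℚᵘ-ι n) ⟩
    ℚᵘ.mkℚᵘ i m ℚᵘ.* ℚᵘ.mkℚᵘ (+ n) 0       ≈⟨ ℚᵘ.*≡* (ℤ-eq i (+ n)) ⟩
    ℚᵘ.mkℚᵘ i 0                            ≈⟨ toℚᵘ-fromℚᵘ (ℚᵘ.mkℚᵘ i 0) ⟨
    toℚᵘ (i / 1)                           ∎)
    where
    open SetoidReasoning ℚᵘ.≃-setoid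
    ℤ-eq : ∀ i d → (i ℤ.* d) ℤ.* + 1 ≡ i ℤ.* (d ℤ.* + 1)
    ℤ-eq = solve-∀

  ι-mono-≤ : ∀ {m n} → m ℕ.≤ n → ι m ≤ ι n
  ι-mono-≤ {m} {n} m≤n = toℚᵘ-cancel-≤
    (ℚᵘ.≤-respʳ-≃ (ℚᵘ.≃-sym (toℚᵘ-ι n)) (ℚᵘ.≤-respˡ-≃ (ℚᵘ.≃-sym (toℚᵘ-ι m))
      (ℚᵘ.*≤* (ℤ.*-monoʳ-≤-nonNeg (+ 1) (ℤ.+≤+ m≤n)))))

  0≤ι : ∀ n → 0ℚ ≤ ι n
  0≤ι n = ι-mono-≤ {0} {n} z≤n

  0≤p∧0≤q⇒0≤p*q : ∀ {p q} → 0ℚ ≤ p → 0ℚ ≤ q → 0ℚ ≤ p * q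
  0≤p∧0≤q⇒0≤p*q {p} {q} 0≤p 0≤q =
    nonNegative⁻¹ (p * q) {{nonNeg*nonNeg⇒nonNeg p {{nonNegative 0≤p}} q {{nonNegative 0≤q}}}}

  x*ι[m]≡ι[n]-* : ∀ {x y m n m′ n′} → x * ι m ≡ ι n → y * ι m′ ≡ ι n′ →
                  x * y * ι (m ℕ.* m′) ≡ ι (n ℕ.* n′)
  x*ι[m]≡ι[n]-* {x} {y} {m} {n} {m′} {n′} x*m≡n y*m′≡n′ = begin
    x * y * ι (m ℕ.* m′)          ≡⟨ cong (x * y *_) (ι-* m m′) ⟩
    x * y * (ι m * ι m′)          ≡⟨ interchange x y (ι m) (ι m′) ⟩
    x * ι m * (y * ι m′)          ≡⟨ cong₂ _*_ x*m≡n y*m′≡n′ ⟩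
    ι n * ι n′                    ≡⟨ ι-* n n′ ⟨
    ι (n ℕ.* n′)                  ∎
    where open ≡-Reasoning

  x*ι[m]≡ι[n]-^ : ∀ {x m n} → x * ι m ≡ ι n → ∀ k → x ^ℚ k * ι (m ℕ.^ k) ≡ ι (n ℕ.^ k)
  x*ι[m]≡ι[n]-^ x*m≡n zero    = refl
  x*ι[m]≡ι[n]-^ {x} {m} {n} x*m≡n (suc k) =
    x*ι[m]≡ι[n]-* {x} {x ^ℚ k} {m} {n} x*m≡n (x*ι[m]≡ι[n]-^ x*m≡n k)

  p≤∣p∣ : ∀ p → p ≤ ∣ p ∣
  p≤∣p∣ p with 0ℚ ≤? p
  ... | yes 0≤p = ≤-reflexive (sym (0≤p⇒∣p∣≡p 0≤p))
  ... | no  0≰p = ≤-trans (<⇒≤ (≰⇒> 0≰p)) (0≤∣p∣ p)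

  0<q-p : ∀ {p q} → p < q → 0ℚ < q - p
  0<q-p {p} {q} p<q = subst (_< q - p) (+-inverseʳ p) (+-monoˡ-< (- p) p<q)

  convergent-not-eventually-far : ∀ {S x ε} n → ConvergesTo S x → 0ℚ < ε →
                                  ¬ (∀ m → n ℕ.≤ m → ε ≤ ∣ S m - x ∣)
  convergent-not-eventually-far {ε = ε} n conv 0<ε far with conv ε 0<ε
  ... | N , close = <-irrefl refl (≤-<-trans (far (N ℕ.+ n) (ℕ.m≤n+m n N)) (close (N ℕ.+ n) (ℕ.m≤m+n N n)))

  limit-≥ : ∀ {S x a} n → ConvergesTo S x → (∀ m → n ℕ.≤ m → a ≤ S m) → a ≤ x
  limit-≥ {S} {x} {a} n conv a≤S with a ≤? x
  ... | yes a≤x = a≤x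
  ... | no  a≰x = contradiction far (convergent-not-eventually-far {S} n conv (0<q-p (≰⇒> a≰x)))
    where
    far : ∀ m → n ℕ.≤ m → a - x ≤ ∣ S m - x ∣
    far m n≤m = ≤-trans (+-monoˡ-≤ (- x) (a≤S m n≤m)) (p≤∣p∣ (S m - x))

  limit-≤ : ∀ {S x b} n → ConvergesTo S x → (∀ m → n ℕ.≤ m → S m ≤ b) → x ≤ b
  limit-≤ {S} {x} {b} n conv S≤b with x ≤? b
  ... | yes x≤b = x≤b
  ... | no  x≰b = contradiction far (convergent-not-eventually-far {S} n conv (0<q-p (≰⇒> x≰b)))
    where
    open +-*-Solver
    x-s≡-[s-x] : ∀ s x → x - s ≡ - (s - x)
    x-s≡-[s-x] = solve 2 (λ s x → x :- s := :- (s :- x)) refl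
    far : ∀ m → n ℕ.≤ m → x - b ≤ ∣ S m - x ∣
    far m n≤m = ≤-trans (+-monoʳ-≤ x (neg-antimono-≤ (S≤b m n≤m)))
                  (subst (_≤ ∣ S m - x ∣) (sym (x-s≡-[s-x] (S m) x))
                    (subst (- (S m - x) ≤_) (∣-p∣≡∣p∣ (S m - x)) (p≤∣p∣ (- (S m - x)))))

  suc-step⇒monotone : ∀ {_∼_ : ℚ → ℚ → Set} →
    (∀ {p} → p ∼ p) → (∀ {p q r} → p ∼ q → q ∼ r → p ∼ r) →
    ∀ {f : ℕ → ℚ} → (∀ n → f n ∼ f (suc n)) → ∀ {n m} → n ℕ.≤ m → f n ∼ f m
  suc-step⇒monotone refl′ trans′ step {m = zero} z≤n = refl′
  suc-step⇒monotone {_∼_} refl′ trans′ {f} step {n} {suc m} n≤1+m with ℕ.m≤n⇒m<n∨m≡n n≤1+m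
  ... | inj₁ (s≤s n≤m) = trans′ (suc-step⇒monotone {_∼_} refl′ trans′ {f} step n≤m) (step m)
  ... | inj₂ refl      = refl′

  module DigitExpansion {q-1 : ℕ} (d : ℕ → Fin (suc q-1)) where

    q : ℕ
    q = suc q-1

    S : ℕ → ℚ
    S = partialSum q d

    digit : ℕ → ℕ
    digit n = toℕ (d n)

    q⁻ⁿ : ℕ → ℚ
    q⁻ⁿ n = inv q ^ℚ n

    q⁻ⁿ*ι[qⁿ]≡1 : ∀ n → q⁻ⁿ n * ι (q ℕ.^ n) ≡ 1ℚ
    q⁻ⁿ*ι[qⁿ]≡1 n = trans (x*ι[m]≡ι[n]-^ (/-*-ι (+ 1) q) n) (cong ι (ℕ.^-zeroˡ n))

    0≤q⁻ⁿ : ∀ n → 0ℚ ≤ q⁻ⁿ n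
    0≤q⁻ⁿ zero    = 0≤ι 1
    0≤q⁻ⁿ (suc n) = 0≤p∧0≤q⇒0≤p*q (nonNegative⁻¹ (inv q) {{normalize-nonNeg 1 q}}) (0≤q⁻ⁿ n)

    S-mono : ∀ {n m} → n ℕ.≤ m → S n ≤ S m
    S-mono = suc-step⇒monotone {_≤_} ≤-refl ≤-trans {S} S≤S[1+n]
      where
      S≤S[1+n] : ∀ n → S n ≤ S (suc n)
      S≤S[1+n] n = subst (_≤ S (suc n)) (+-identityʳ (S n))
                     (+-monoʳ-≤ (S n) (0≤p∧0≤q⇒0≤p*q (0≤ι (digit n)) (0≤q⁻ⁿ (suc n))))

    S+q⁻ⁿ-antimono : ∀ {n m} → n ℕ.≤ m → S m + q⁻ⁿ m ≤ S n + q⁻ⁿ n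
    S+q⁻ⁿ-antimono =
      suc-step⇒monotone {_≥_} ≤-refl (λ p≥q q≥r → ≤-trans q≥r p≥q) {λ n → S n + q⁻ⁿ n} step
      where
      step : ∀ n → S (suc n) + q⁻ⁿ (suc n) ≤ S n + q⁻ⁿ n
      step n = begin
        S n + ι (digit n) * q⁻ⁿ (suc n) + q⁻ⁿ (suc n)  ≡⟨ collect (S n) (ι (digit n)) (q⁻ⁿ (suc n)) ⟩
        S n + (ι (digit n) + 1ℚ) * q⁻ⁿ (suc n)         ≡⟨ cong (λ z → S n + z * q⁻ⁿ (suc n)) (ι-+ (digit n) 1) ⟨
        S n + ι (digit n ℕ.+ 1) * q⁻ⁿ (suc n)          ≤⟨ +-monoʳ-≤ (S n) (*-monoʳ-≤-nonNeg (q⁻ⁿ (suc n))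
                                                            {{nonNegative (0≤q⁻ⁿ (suc n))}} (ι-mono-≤ digit+1≤q)) ⟩
        S n + ι q * (inv q * q⁻ⁿ n)                    ≡⟨ cong (_+_ (S n)) (*-assoc (ι q) (inv q) (q⁻ⁿ n)) ⟨
        S n + ι q * inv q * q⁻ⁿ n                      ≡⟨ cong (λ z → S n + z * q⁻ⁿ n) (trans (*-comm (ι q) (inv q)) (/-*-ι (+ 1) q)) ⟩
        S n + 1ℚ * q⁻ⁿ n                               ≡⟨ cong (_+_ (S n)) (*-identityˡ (q⁻ⁿ n)) ⟩
        S n + q⁻ⁿ n                                    ∎
        where
        open ≤-Reasoning
        open +-*-Solver
        collect : ∀ s δ u → s + δ * u + u ≡ s + (δ + 1ℚ) * u
        collect = solve 3 (λ s δ u → s :+ δ :* u :+ u := s :+ (δ :+ con 1ℚ) :* u) refl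
        digit+1≤q : digit n ℕ.+ 1 ℕ.≤ q
        digit+1≤q = subst (ℕ._≤ q) (ℕ.+-comm 1 (digit n)) (toℕ<n (d n))

    leading : ℕ → ℕ
    leading zero    = 0
    leading (suc n) = q ℕ.* leading n ℕ.+ digit n

    S*ι[qⁿ]≡ι[leading] : ∀ n → S n * ι (q ℕ.^ n) ≡ ι (leading n)
    S*ι[qⁿ]≡ι[leading] zero    = refl
    S*ι[qⁿ]≡ι[leading] (suc n) = begin
      (S n + ι (digit n) * q⁻ⁿ (suc n)) * ι (q ℕ.* q ℕ.^ n)
        ≡⟨ *-distribʳ-+ (ι (q ℕ.* q ℕ.^ n)) (S n) _ ⟩
      S n * ι (q ℕ.* q ℕ.^ n) + ι (digit n) * q⁻ⁿ (suc n) * ι (q ℕ.^ suc n)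
        ≡⟨ cong₂ _+_ (cong (S n *_) (ι-* q (q ℕ.^ n))) (*-assoc (ι (digit n)) _ _) ⟩
      S n * (ι q * ι (q ℕ.^ n)) + ι (digit n) * (q⁻ⁿ (suc n) * ι (q ℕ.^ suc n))
        ≡⟨ cong₂ _+_ (x∙yz≈y∙xz (S n) (ι q) (ι (q ℕ.^ n))) (cong (ι (digit n) *_) (q⁻ⁿ*ι[qⁿ]≡1 (suc n))) ⟩
      ι q * (S n * ι (q ℕ.^ n)) + ι (digit n) * 1ℚ
        ≡⟨ cong₂ (λ a b → ι q * a + b) (S*ι[qⁿ]≡ι[leading] n) (*-identityʳ (ι (digit n))) ⟩
      ι q * ι (leading n) + ι (digit n)
        ≡⟨ cong (_+ ι (digit n)) (ι-* q (leading n)) ⟨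
      ι (q ℕ.* leading n) + ι (digit n)
        ≡⟨ ι-+ (q ℕ.* leading n) (digit n) ⟨
      ι (leading (suc n))
        ∎
      where open ≡-Reasoning

    module Converging {x : ℚ} (conv : ConvergesTo S x) where

      S≤x : ∀ n → S n ≤ x
      S≤x n = limit-≥ n conv (λ m → S-mono)

      x≤S+q⁻ⁿ : ∀ n → x ≤ S n + q⁻ⁿ n
      x≤S+q⁻ⁿ n = limit-≤ n conv (λ m n≤m → ≤-trans (S≤S+q⁻ⁿ m) (S+q⁻ⁿ-antimono n≤m))
        where
        S≤S+q⁻ⁿ : ∀ m → S m ≤ S m + q⁻ⁿ m
        S≤S+q⁻ⁿ m = subst (_≤ S m + q⁻ⁿ m) (+-identityʳ (S m)) (+-monoʳ-≤ (S m) (0≤q⁻ⁿ m))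

      module Remainders {D N : ℕ} (x*D≡N : x * ι D ≡ ι N) where

        private
          scale : ∀ n {a b} → a ≤ b → a * ι (D ℕ.* q ℕ.^ n) ≤ b * ι (D ℕ.* q ℕ.^ n)
          scale n = *-monoʳ-≤-nonNeg (ι (D ℕ.* q ℕ.^ n)) {{nonNegative (0≤ι (D ℕ.* q ℕ.^ n))}}

          x*ι[D*qⁿ]≡ι[N*qⁿ] : ∀ n → x * ι (D ℕ.* q ℕ.^ n) ≡ ι (N ℕ.* q ℕ.^ n)
          x*ι[D*qⁿ]≡ι[N*qⁿ] n = begin
            x * ι (D ℕ.* q ℕ.^ n)          ≡⟨ cong (x *_) (ι-* D (q ℕ.^ n)) ⟩
            x * (ι D * ι (q ℕ.^ n))        ≡⟨ *-assoc x (ι D) _ ⟨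
            x * ι D * ι (q ℕ.^ n)          ≡⟨ cong (_* ι (q ℕ.^ n)) x*D≡N ⟩
            ι N * ι (q ℕ.^ n)              ≡⟨ ι-* N (q ℕ.^ n) ⟨
            ι (N ℕ.* q ℕ.^ n)              ∎
            where open ≡-Reasoning

          S*ι[D*qⁿ]≡ι[D*leading] : ∀ n → S n * ι (D ℕ.* q ℕ.^ n) ≡ ι (D ℕ.* leading n)
          S*ι[D*qⁿ]≡ι[D*leading] n = begin
            S n * ι (D ℕ.* q ℕ.^ n)        ≡⟨ cong (S n *_) (ι-* D (q ℕ.^ n)) ⟩
            S n * (ι D * ι (q ℕ.^ n))      ≡⟨ x∙yz≈y∙xz (S n) (ι D) _ ⟩
            ι D * (S n * ι (q ℕ.^ n))      ≡⟨ cong (ι D *_) (S*ι[qⁿ]≡ι[leading] n) ⟩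
            ι D * ι (leading n)            ≡⟨ ι-* D (leading n) ⟨
            ι (D ℕ.* leading n)            ∎
            where open ≡-Reasoning

          q⁻ⁿ*ι[D*qⁿ]≡ι[D] : ∀ n → q⁻ⁿ n * ι (D ℕ.* q ℕ.^ n) ≡ ι D
          q⁻ⁿ*ι[D*qⁿ]≡ι[D] n = begin
            q⁻ⁿ n * ι (D ℕ.* q ℕ.^ n)      ≡⟨ cong (q⁻ⁿ n *_) (ι-* D (q ℕ.^ n)) ⟩
            q⁻ⁿ n * (ι D * ι (q ℕ.^ n))    ≡⟨ x∙yz≈y∙xz (q⁻ⁿ n) (ι D) _ ⟩
            ι D * (q⁻ⁿ n * ι (q ℕ.^ n))    ≡⟨ cong (ι D *_) (q⁻ⁿ*ι[qⁿ]≡1 n) ⟩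
            ι D * 1ℚ                       ≡⟨ *-identityʳ (ι D) ⟩
            ι D                            ∎
            where open ≡-Reasoning

        D*leading≤N*qⁿ : ∀ n → D ℕ.* leading n ℕ.≤ N ℕ.* q ℕ.^ n
        D*leading≤N*qⁿ n =
          ι-cancel-≤ (subst₂ _≤_ (S*ι[D*qⁿ]≡ι[D*leading] n) (x*ι[D*qⁿ]≡ι[N*qⁿ] n) (scale n (S≤x n)))

        N*qⁿ≤D*leading+D : ∀ n → N ℕ.* q ℕ.^ n ℕ.≤ D ℕ.* leading n ℕ.+ D
        N*qⁿ≤D*leading+D n = ι-cancel-≤ (subst₂ _≤_ (x*ι[D*qⁿ]≡ι[N*qⁿ] n) upper (scale n (x≤S+q⁻ⁿ n)))
          where
          upper : (S n + q⁻ⁿ n) * ι (D ℕ.* q ℕ.^ n) ≡ ι (D ℕ.* leading n ℕ.+ D)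
          upper = trans (*-distribʳ-+ _ (S n) (q⁻ⁿ n))
                    (trans (cong₂ _+_ (S*ι[D*qⁿ]≡ι[D*leading] n) (q⁻ⁿ*ι[D*qⁿ]≡ι[D] n))
                           (sym (ι-+ (D ℕ.* leading n) D)))

        -- The truncated subtraction is exact by D*leading≤N*qⁿ.
        R : ℕ → ℕ
        R n = N ℕ.* q ℕ.^ n ℕ.∸ D ℕ.* leading n

        R+D*leading≡N*qⁿ : ∀ n → R n ℕ.+ D ℕ.* leading n ≡ N ℕ.* q ℕ.^ n
        R+D*leading≡N*qⁿ n = ℕ.m∸n+n≡m (D*leading≤N*qⁿ n)

        R≤D : ∀ n → R n ℕ.≤ D
        R≤D n = ℕ.m≤n+o⇒m∸n≤o (N ℕ.* q ℕ.^ n) (D ℕ.* leading n) (N*qⁿ≤D*leading+D n)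

        R≡N*qⁿ : ∀ n → R n ≡ N ℕ.* q ℕ.^ n mod D
        R≡N*qⁿ n = leading n , 0 , trans (cong (R n ℕ.+_) (ℕ.*-comm (leading n) D))
                                         (trans (R+D*leading≡N*qⁿ n) (sym (ℕ.+-identityʳ _)))

        R[1+n]+D*digit≡q*R : ∀ n → R (suc n) ℕ.+ D ℕ.* digit n ≡ q ℕ.* R n
        R[1+n]+D*digit≡q*R n = ℕ.+-cancelʳ-≡ (D ℕ.* (q ℕ.* leading n)) _ _ (begin
          R (suc n) ℕ.+ D ℕ.* digit n ℕ.+ D ℕ.* (q ℕ.* leading n)  ≡⟨ regroup (R (suc n)) D q (leading n) (digit n) ⟩
          R (suc n) ℕ.+ D ℕ.* leading (suc n)                     ≡⟨ R+D*leading≡N*qⁿ (suc n) ⟩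
          N ℕ.* (q ℕ.* q ℕ.^ n)                                   ≡⟨ ℕ-x∙yz≈y∙xz N q (q ℕ.^ n) ⟩
          q ℕ.* (N ℕ.* q ℕ.^ n)                                   ≡⟨ cong (q ℕ.*_) (R+D*leading≡N*qⁿ n) ⟨
          q ℕ.* (R n ℕ.+ D ℕ.* leading n)                         ≡⟨ distribute q (R n) D (leading n) ⟩
          q ℕ.* R n ℕ.+ D ℕ.* (q ℕ.* leading n)                   ∎)
          where
          open ≡-Reasoning
          regroup : ∀ r D q a d → r ℕ.+ D ℕ.* d ℕ.+ D ℕ.* (q ℕ.* a) ≡ r ℕ.+ D ℕ.* (q ℕ.* a ℕ.+ d)
          regroup = ℕ-solve-∀
          distribute : ∀ q r D a → q ℕ.* (r ℕ.+ D ℕ.* a) ≡ q ℕ.* r ℕ.+ D ℕ.* (q ℕ.* a)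
          distribute = ℕ-solve-∀

        digit-determined : ∀ {c n} → c ℕ.* D ℕ.< q ℕ.* R n → q ℕ.* R n ℕ.< suc c ℕ.* D → digit n ≡ c
        digit-determined {c} {n} cD<qR qR<[1+c]D =
          ℕ.≤-antisym (ℕ.s≤s⁻¹ (ℕ.*-cancelʳ-< D (digit n) (suc c) (ℕ.≤-<-trans eD≤qR qR<[1+c]D)))
                      (ℕ.s≤s⁻¹ (ℕ.*-cancelʳ-< D c (suc (digit n)) (ℕ.<-≤-trans cD<qR qR≤[1+e]D)))
          where
          open ℕ.≤-Reasoning
          eD≤qR : digit n ℕ.* D ℕ.≤ q ℕ.* R n
          eD≤qR = begin
            digit n ℕ.* D                  ≡⟨ ℕ.*-comm (digit n) D ⟩
            D ℕ.* digit n                  ≤⟨ ℕ.m≤n+m _ (R (suc n)) ⟩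
            R (suc n) ℕ.+ D ℕ.* digit n    ≡⟨ R[1+n]+D*digit≡q*R n ⟩
            q ℕ.* R n                      ∎
          qR≤[1+e]D : q ℕ.* R n ℕ.≤ suc (digit n) ℕ.* D
          qR≤[1+e]D = begin
            q ℕ.* R n                      ≡⟨ R[1+n]+D*digit≡q*R n ⟨
            R (suc n) ℕ.+ D ℕ.* digit n    ≤⟨ ℕ.+-monoˡ-≤ _ (R≤D (suc n)) ⟩
            D ℕ.+ D ℕ.* digit n            ≡⟨ cong (D ℕ.+_) (ℕ.*-comm D (digit n)) ⟩
            suc (digit n) ℕ.* D            ∎

open import Data.Nat using (ℕ; _≤_; _<_; NonZero)
open import Data.Nat.Coprimality using (Coprime)
open import Data.Nat.Primality using (Prime)
open import Data.Nat.Divisibility using (_∣_)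
open import Data.Integer using (+_)
open import Data.Rational using (ℚ; 0ℚ; _*_; _/_)
open import Data.Rational as ℚ using ()
open import Data.Fin.Subset using (Subset; ∣_∣)
open import Data.Product using (∃; _×_)
open import Relation.Nullary using (¬_)
open import Data.Nat as ℕ using (zero; suc; z≤n; s≤s; _^_)
import Data.Nat.Properties as ℕ
open import Data.Nat.Divisibility using (divides; ∣-trans; n∣m*n)
open import Data.Nat.Tactic.RingSolver using (solve-∀)
open import Algebra.Properties.CommutativeSemigroup ℕ.*-commutativeSemigroup using (xy∙z≈xz∙y)
open import Data.Integer as ℤ using (+[1+_]; -[1+_]; +0)
open import Data.Rational using (mkℚ; *<*)
open import Data.Rational.Properties using (↥p/↧p≡p)
open import Data.Fin using (Fin; toℕ; zero; suc)
open import Data.Fin.Properties using (toℕ-injective; toℕ<n)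
open import Data.Fin.Subset using (_∈_; _∉_; inside; outside)
open import Data.Fin.Subset.Properties using (drop-there)
open import Data.Vec using (_∷_)
open import Data.Product using (∃₂; _,_)
open import Data.Sum using (inj₁; inj₂)
open import Function using (case_of_; _∘′_)
open import Relation.Binary.PropositionalEquality
open Arithmetic
open Periods
open Orbits
open Expansions

∣p∣<n⇒∃∉ : ∀ {n} (p : Subset n) → ∣ p ∣ < n → ∃ λ x → x ∉ p
∣p∣<n⇒∃∉ (outside ∷ p) _ = zero , λ ()
∣p∣<n⇒∃∉ (inside  ∷ p) (s≤s ∣p∣<n) with ∣p∣<n⇒∃∉ p ∣p∣<n
... | x , x∉p = suc x , x∉p ∘′ drop-there

positive⇒∃ratio : ∀ α → 0ℚ ℚ.< α → ∃₂ λ a b → α * ι (suc b) ≡ ι (suc a)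
positive⇒∃ratio α@(mkℚ +[1+ a ] b _) _ =
  a , b , trans (cong (_* ι (suc b)) (sym (↥p/↧p≡p α))) (/-*-ι +[1+ a ] (suc b))
positive⇒∃ratio (mkℚ +0       _ _) (*<* (ℤ.+<+ ()))
positive⇒∃ratio (mkℚ -[1+ _ ] _ _) (*<* ())

α*r^k*ι[b*t^k]≡ι[a*s^k] : ∀ {α a b s t} .{{_ : NonZero t}} → α * ι b ≡ ι a →
                           ∀ k → α * ((+ s) / t) ^ℚ k * ι (b ℕ.* t ^ k) ≡ ι (a ℕ.* s ^ k)
α*r^k*ι[b*t^k]≡ι[a*s^k] {α} {a} {b} {s} {t} α*b≡a k =
  x*ι[m]≡ι[n]-* {α} {((+ s) / t) ^ℚ k} {b} {a} α*b≡a (x*ι[m]≡ι[n]-^ {(+ s) / t} {t} {s} (/-*-ι (+ s) t) k)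

orbit-in-digit-interval⇒∉K : ∀ {q-1 A D N x} {c : Fin (suc q-1)} → c ∉ A → x * ι D ≡ ι N →
  OrbitMeetsInterval (suc q-1) N D (toℕ c) →
  ¬ InK (suc q-1) A x
orbit-in-digit-interval⇒∉K {q-1} {A} {D} {N} {x} {c} c∉A x*D≡N
                           (n , v , N*qⁿ≡v , cD<qv , qv<[1+c]D) (d , d∈A , conv) =
  case ≡-mod⇒≡⊎boundary (≡-mod-trans (R≡N*qⁿ n) N*qⁿ≡v) v<D (R≤D n) of λ where
    (inj₁ R≡v)       → c∉A (subst (_∈ A) (d[n]≡c R≡v) (d∈A n))
    (inj₂ (_ , v≡0)) → ℕ.n≮0 (subst (toℕ c ℕ.* D <_) (trans (cong (q ℕ.*_) v≡0) (ℕ.*-zeroʳ q)) cD<qv)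
  where
  open DigitExpansion d
  open Converging conv
  open Remainders {D} {N} x*D≡N
  v<D : v < D
  v<D = ℕ.*-cancelˡ-< q v D (ℕ.<-≤-trans qv<[1+c]D (ℕ.*-monoˡ-≤ D (toℕ<n c)))
  instance
    D≢0 : NonZero D
    D≢0 = ℕ.>-nonZero (ℕ.≤-<-trans z≤n v<D)
  d[n]≡c : R n ≡ v → d n ≡ c
  d[n]≡c R≡v = toℕ-injective (digit-determined (subst (λ r → toℕ c ℕ.* D < q ℕ.* r) (sym R≡v) cD<qv)
                                                (subst (λ r → q ℕ.* r < suc (toℕ c) ℕ.* D) (sym R≡v) qv<[1+c]D))

module BeyondThreshold {p q-1 s t a b δ γ β a' b' τ e₀ : ℕ}
         (p-prime : Prime p) (p∤q : ¬ p ∣ suc q-1) (p∤s : ¬ p ∣ s)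
         (a≡p^δa' : a ≡ p ^ δ ℕ.* a') (p∤a' : ¬ p ∣ a') (b≡p^γb' : b ≡ p ^ γ ℕ.* b') (p∤b' : ¬ p ∣ b')
         (t≡p^[1+β]τ : t ≡ p ^ suc β ℕ.* τ) (p∤τ : ¬ p ∣ τ)
         (per₀ : Period p (suc q-1) (p ^ 2 ℕ.* (b' ℕ.* τ)) (2 ℕ.+ e₀)) where

  open PrimePowers p-prime

  private
    q = suc q-1
    G : ℕ → ℕ
    G k = b' ℕ.* τ ^ k

  -- For k ≥ threshold the exponent γ + (1 + β) k ≥ k of p in b t ^ k splits as (f + δ) + (1 + q)
  -- with f ≥ 2 + e₀ and f ≥ 1 + q, as orbit-meets-interval needs for g = q.
  threshold : ℕ
  threshold = 2 ℕ.+ e₀ ℕ.+ δ ℕ.+ suc q ℕ.+ suc q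

  b*t^k≡p^μ*G : ∀ k → b ℕ.* t ^ k ≡ p ^ (γ ℕ.+ suc β ℕ.* k) ℕ.* G k
  b*t^k≡p^μ*G k = begin
    b ℕ.* t ^ k
      ≡⟨ cong₂ (λ b t → b ℕ.* t ^ k) b≡p^γb' t≡p^[1+β]τ ⟩
    p ^ γ ℕ.* b' ℕ.* (p ^ suc β ℕ.* τ) ^ k
      ≡⟨ cong (p ^ γ ℕ.* b' ℕ.*_) (^-distribʳ-* (p ^ suc β) τ k) ⟩
    p ^ γ ℕ.* b' ℕ.* ((p ^ suc β) ^ k ℕ.* τ ^ k)
      ≡⟨ cong (λ x → p ^ γ ℕ.* b' ℕ.* (x ℕ.* τ ^ k)) (ℕ.^-*-assoc p (suc β) k) ⟩
    p ^ γ ℕ.* b' ℕ.* (p ^ (suc β ℕ.* k) ℕ.* τ ^ k)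
      ≡⟨ ℕ.[m*n]*[o*p]≡[m*o]*[n*p] (p ^ γ) b' _ _ ⟩
    p ^ γ ℕ.* p ^ (suc β ℕ.* k) ℕ.* G k
      ≡⟨ cong (ℕ._* G k) (ℕ.^-distribˡ-+-* p γ (suc β ℕ.* k)) ⟨
    p ^ (γ ℕ.+ suc β ℕ.* k) ℕ.* G k
      ∎
    where open ≡-Reasoning

  k≤μ : ∀ k → k ≤ γ ℕ.+ suc β ℕ.* k
  k≤μ k = ℕ.≤-trans (ℕ.m≤m+n k (β ℕ.* k)) (ℕ.m≤n+m (suc β ℕ.* k) γ)

  orbit-meets-interval-beyond-threshold : ∀ k → threshold ≤ k → ∀ c →
    OrbitMeetsInterval q (a ℕ.* s ^ k) (b ℕ.* t ^ k) c
  orbit-meets-interval-beyond-threshold k th≤k c with ℕ.m≤n⇒∃[o]m+o≡n (ℕ.≤-trans th≤k (k≤μ k))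
  ... | w , th+w≡μ = subst (λ D → OrbitMeetsInterval q (a ℕ.* s ^ k) D c) D≡b*t^k
    (orbit-meets-interval p-prime c p∤q (∤-* p∤b' (∤-^ k p∤τ)) a*s^k≡p^δ*a'*s^k (∤-* p∤a' (∤-^ k p∤s))
      per q<f (2*n≤p^[1+n] q))
    where
    f = 2 ℕ.+ (suc q ℕ.+ w ℕ.+ e₀)
    per : Period p q (G k) f
    per = Period-+ p-prime (suc q ℕ.+ w) (Period-resp-∣ G∣Mτ^k (Period-*^ p-prime τ∣M p∤τ per₀ k))
      where
      τ∣M : τ ∣ p ^ 2 ℕ.* (b' ℕ.* τ)
      τ∣M = ∣-trans (n∣m*n b') (n∣m*n (p ^ 2))
      G∣Mτ^k : G k ∣ p ^ 2 ℕ.* (b' ℕ.* τ) ℕ.* τ ^ k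
      G∣Mτ^k = divides (p ^ 2 ℕ.* τ) (rearrange (p ^ 2) b' τ (τ ^ k))
        where
        rearrange : ∀ P b τ T → P ℕ.* (b ℕ.* τ) ℕ.* T ≡ P ℕ.* τ ℕ.* (b ℕ.* T)
        rearrange = solve-∀
    q<f : suc q ≤ f
    q<f = ℕ.≤-trans (ℕ.≤-trans (ℕ.m≤m+n (suc q) w) (ℕ.m≤m+n _ e₀)) (ℕ.m≤n+m _ 2)
    D≡b*t^k : p ^ (f ℕ.+ δ) ℕ.* G k ℕ.* p ^ suc q ≡ b ℕ.* t ^ k
    D≡b*t^k = begin
      p ^ (f ℕ.+ δ) ℕ.* G k ℕ.* p ^ suc q      ≡⟨ xy∙z≈xz∙y (p ^ (f ℕ.+ δ)) (G k) (p ^ suc q) ⟩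
      p ^ (f ℕ.+ δ) ℕ.* p ^ suc q ℕ.* G k      ≡⟨ cong (ℕ._* G k) (ℕ.^-distribˡ-+-* p (f ℕ.+ δ) (suc q)) ⟨
      p ^ (f ℕ.+ δ ℕ.+ suc q) ℕ.* G k          ≡⟨ cong (λ e → p ^ e ℕ.* G k) (trans (exponent e₀ δ q w) th+w≡μ) ⟩
      p ^ (γ ℕ.+ suc β ℕ.* k) ℕ.* G k          ≡⟨ b*t^k≡p^μ*G k ⟨
      b ℕ.* t ^ k                              ∎
      where
      open ≡-Reasoning
      exponent : ∀ e₀ δ q w → 2 ℕ.+ (suc q ℕ.+ w ℕ.+ e₀) ℕ.+ δ ℕ.+ suc q
                              ≡ 2 ℕ.+ e₀ ℕ.+ δ ℕ.+ suc q ℕ.+ suc q ℕ.+ w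
      exponent = solve-∀
    a*s^k≡p^δ*a'*s^k : a ℕ.* s ^ k ≡ p ^ δ ℕ.* (a' ℕ.* s ^ k)
    a*s^k≡p^δ*a'*s^k = trans (cong (ℕ._* s ^ k) a≡p^δa') (ℕ.*-assoc (p ^ δ) a' (s ^ k))

theorem1p5 : (q : ℕ) → 3 ≤ q → (A : Subset q) → 1 < ∣ A ∣ → ∣ A ∣ < q →
    (s t : ℕ) → .{{_ : NonZero t}} → Coprime s t → 0 < s → s < t →
    (∃ λ p → Prime p × p ∣ t × ¬ (p ∣ q)) →
    (α : ℚ) → 0ℚ ℚ.< α →
    ∃ λ B → ∀ k → InK q A (α * (((+ s) / t) ^ℚ k)) → k < B
theorem1p5 (suc q-1) 3≤q A _ ∣A∣<q s t cop _ _ (p , p-prime , p∣t , p∤q) α 0<α =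
  let open PrimePowers p-prime
      (c , c∉A)                  = ∣p∣<n⇒∃∉ A ∣A∣<q
      (a-1 , b-1 , α*b≡a)        = positive⇒∃ratio α 0<α
      (δ , a' , a≡p^δa' , p∤a')  = p-adic-split (suc a-1)
      (γ , b' , b≡p^γb' , p∤b')  = p-adic-split (suc b-1)
      (β , τ , t≡p^[1+β]τ , p∤τ) = p∣⇒p-adic-split p∣t
      (e₀ , per₀)                = ∃Period p-prime (ℕ.≤-trans (ℕ.n≤1+n 2) 3≤q) p∤q (∤-* p∤b' p∤τ)
      open BeyondThreshold {δ = δ} {γ = γ} {β = β} p-prime p∤q (coprime∧p∣⇒p∤ cop p∣t)
             a≡p^δa' p∤a' b≡p^γb' p∤b' t≡p^[1+β]τ p∤τ per₀
  in threshold , λ k inK → ℕ.≰⇒> λ threshold≤k →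
       orbit-in-digit-interval⇒∉K {D = suc b-1 ℕ.* t ^ k} {N = suc a-1 ℕ.* s ^ k} c∉A
         (α*r^k*ι[b*t^k]≡ι[a*s^k] {α} {suc a-1} {suc b-1} {s} α*b≡a k)
         (orbit-meets-interval-beyond-threshold k threshold≤k (toℕ c)) inK
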